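{- Let $L$ be a Latin square of order $n\geq 2$ and let $k\geq 1$ be an integer. If $P\subseteq L$ is minimally $k$-strong, then there is a partial Latin square $Q\subsetneq P$ which is minimally $(k-1)$-strong.
   Context: A partial Latin square (PLS) of order $n$ is an $n\times n$ array in which some cells may be empty and each of $n$ symbols occurs at most once in each row and column; a Latin square is a PLS with no empty cells. Arrays are identified with their sets of triples $(i,j;L_{i,j})$. A Latin trade is a non-empty PLS $T$ for which there is a PLS $T'$ of the same order with $T\cap T'=\emptyset$, the same set of non-empty cells as $T$, and the same set of symbols as $T$ in each row and in each column. A defining set of $L$ is a subset of $L$ contained in no other Latin square of the same order. For an integer $k\geq 0$, a subset $S\subseteq L$ is called $k$-strong if $|S\cap T|\geq k$ for every Latin trade $T\subseteq L$ (for $k\geq 1$ such an $S$ is automatically a defining set, and these are the $k$-strong defining sets); $S$ is minimally $k$-strong if it is $k$-strong but no proper subset of $S$ is $k$-strong. -}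

module Defs where

open import Data.Nat using (ℕ; _+_; _≤_)
open import Data.Fin using (Fin)
open import Data.Bool using (Bool; true; false; if_then_else_; _∧_)
open import Data.List using (List; map; allFin)
open import Data.Nat.ListAction using (sum)
open import Data.Product using (_×_; ∃; ∃-syntax; _,_)
open import Relation.Binary.PropositionalEquality using (_≡_)
open import Relation.Nullary using (¬_)
open import Function.Bundles using (_⇔_)

-- A set of triples (row, column; symbol) over Fin n, as a decidable (Bool-valued) predicate.
Triples : ℕ → Set
Triples n = Fin n → Fin n → Fin n → Bool

module _ {n : ℕ} where

  _∈T_ : (Fin n × Fin n × Fin n) → Triples n → Set
  (r , c , s) ∈T S = S r c s ≡ true

  _⊆T_ : Triples n → Triples n → Set
  S ⊆T S' = ∀ r c s → S r c s ≡ true → S' r c s ≡ true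

  _⊊T_ : Triples n → Triples n → Set
  S ⊊T S' = S ⊆T S' × ∃[ r ] ∃[ c ] ∃[ s ] (S' r c s ≡ true × ¬ (S r c s ≡ true))

  _∩T_ : Triples n → Triples n → Triples n
  (S ∩T S') r c s = S r c s ∧ S' r c s

  card : Triples n → ℕ
  card S = sum (map (λ r → sum (map (λ c → sum (map (λ s → if S r c s then 1 else 0)
             (allFin n))) (allFin n))) (allFin n))

  IsPLS : Triples n → Set
  IsPLS S =
    (∀ r c s s' → S r c s ≡ true → S r c s' ≡ true → s ≡ s') ×
    (∀ r c c' s → S r c s ≡ true → S r c' s ≡ true → c ≡ c') ×
    (∀ r r' c s → S r c s ≡ true → S r' c s ≡ true → r ≡ r')

  IsLatinSquare : Triples n → Set
  IsLatinSquare L = IsPLS L × (∀ r c → ∃[ s ] L r c s ≡ true)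

  IsLatinTrade : Triples n → Set
  IsLatinTrade T =
    IsPLS T × (∃[ r ] ∃[ c ] ∃[ s ] T r c s ≡ true) ×
    ∃[ T' ] (IsPLS T' ×
      (∀ r c s → T r c s ≡ true → ¬ (T' r c s ≡ true)) ×
      (∀ r c → (∃[ s ] T r c s ≡ true) ⇔ (∃[ s ] T' r c s ≡ true)) ×
      (∀ r s → (∃[ c ] T r c s ≡ true) ⇔ (∃[ c ] T' r c s ≡ true)) ×
      (∀ c s → (∃[ r ] T r c s ≡ true) ⇔ (∃[ r ] T' r c s ≡ true)))

  IsKStrong : ℕ → Triples n → Triples n → Set
  IsKStrong k L S = S ⊆T L × (∀ T → T ⊆T L → IsLatinTrade T → k ≤ card (S ∩T T))

  IsMinimallyKStrong : ℕ → Triples n → Triples n → Set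
  IsMinimallyKStrong k L S = IsKStrong k L S × (∀ S' → S' ⊊T S → ¬ IsKStrong k L S')

{-# OPTIONS --safe #-}
-- A Latin square L of order at least 2 is itself a Latin trade: shifting its rows
-- cyclically gives a disjoint Latin square with the same cells and the same symbols
-- in every row and column. Hence a k-strong P with k ≥ 1 meets L, so it contains
-- some triple t. Deleting t lowers |P ∩ T| by at most one for every trade T, so
-- P − t is (k−1)-strong. Strength is upward closed and, over a fixed finite order,
-- decidable; so deleting triples from P − t one at a time while (k−1)-strength
-- survives ends in a minimally (k−1)-strong Q ⊆ P − t ⊊ P.
module Submission where

open import Defs
open import Data.Nat using (ℕ; _≤_; _∸_; suc; _+_; _*_; _<_; z≤n; s≤s; _≤?_)
open import Data.Product using (_×_; ∃-syntax; ∃; _,_; proj₁; proj₂; map₂; uncurry; swap)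
open import Data.Bool using (Bool; true; false; if_then_else_; _∧_)
open import Data.Bool.Properties using (∧-conicalˡ; ∧-conicalʳ) renaming (_≟_ to _≟ᵇ_)
open import Data.Empty using (⊥-elim)
open import Data.Fin using (Fin; zero; suc; fromℕ; inject₁; toℕ; punchOut; combine; remQuot)
open import Data.Fin.Properties
  using (_≟_; all?; any?; suc-injective; inject₁-injective; fromℕ≢inject₁; toℕ-inject₁;
         punchOut-injective; injective⇒≤; remQuot-combine)
open import Data.Fin.Subset using (Subset)
open import Data.Fin.Subset.Properties using (anySubset?)
open import Data.List using (List; []; _∷_; map; allFin; tabulate)
open import Data.List.Properties using (map-tabulate; tabulate-cong; map-cong)
open import Data.Nat.Induction using (<-wellFounded)
open import Data.Nat.ListAction using (sum)
open import Data.Nat.Properties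
  using (≤-refl; ≤-reflexive; ≤-trans; +-mono-≤; +-monoˡ-≤; +-assoc; +-identityʳ; ∸-monoˡ-≤;
         1+n≰n; 1+n≢n; +-commutativeSemigroup; module ≤-Reasoning)
open import Algebra.Properties.CommutativeSemigroup +-commutativeSemigroup using (x∙yz≈y∙xz)
open import Data.Product.Properties using (≡-dec)
open import Data.Vec using (lookup) renaming (tabulate to tabulateᵛ)
open import Data.Vec.Properties using (lookup∘tabulate)
open import Function using (_∘_; id)
open import Function.Bundles using (_⇔_; mk⇔; Equivalence)
open import Function.Definitions using (Injective; StrictlySurjective)
open import Function.Properties.Equivalence using () renaming (trans to ⇔-trans)
open import Induction.WellFounded using (Acc; acc)
open import Relation.Binary.Definitions using (DecidableEquality; _Respects_)
open import Relation.Binary.PropositionalEquality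
  using (_≡_; _≢_; refl; sym; trans; cong; cong₂; subst; module ≡-Reasoning)
open import Relation.Nullary using (¬_; Dec; yes; no; does; ¬?)
open import Relation.Nullary.Decidable
  using (_×-dec_; _→-dec_; dec-true; dec-false; decidable-stable) renaming (map to map-dec)

indicator : Bool → ℕ
indicator b = if b then 1 else 0

indicator-mono : {a b : Bool} → (a ≡ true → b ≡ true) → indicator a ≤ indicator b
indicator-mono {false} _   = z≤n
indicator-mono {true}  a⇒b rewrite a⇒b refl = ≤-refl

indicator-≤1 : (b : Bool) → indicator b ≤ 1
indicator-≤1 false = z≤n
indicator-≤1 true  = ≤-refl

sum-map-mono : {A : Set} {f g : A → ℕ} (xs : List A) →
               (∀ x → f x ≤ g x) → sum (map f xs) ≤ sum (map g xs)
sum-map-mono []       _   = z≤n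
sum-map-mono (x ∷ xs) f≤g = +-mono-≤ (f≤g x) (sum-map-mono xs f≤g)

sum-map-zero : {A : Set} {f : A → ℕ} (xs : List A) → (∀ x → f x ≡ 0) → sum (map f xs) ≡ 0
sum-map-zero []       _   = refl
sum-map-zero (x ∷ xs) f≡0 = cong₂ _+_ (f≡0 x) (sum-map-zero xs f≡0)

sum-map-cong : {A : Set} {f g : A → ℕ} (xs : List A) →
               (∀ x → f x ≡ g x) → sum (map f xs) ≡ sum (map g xs)
sum-map-cong xs f≡g = cong sum (map-cong f≡g xs)

sum-tabulate-update : ∀ {m d} {f g : Fin m → ℕ} (i₀ : Fin m) →
                      (∀ i → i ≢ i₀ → f i ≡ g i) → f i₀ ≡ d + g i₀ →
                      sum (tabulate f) ≡ d + sum (tabulate g)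
sum-tabulate-update {d = d} {f} {g} zero f≡g f₀≡ = begin
  f zero + sum (tabulate (f ∘ suc))
    ≡⟨ cong₂ _+_ f₀≡ (cong sum (tabulate-cong λ i → f≡g (suc i) λ ())) ⟩
  d + g zero + sum (tabulate (g ∘ suc))    ≡⟨ +-assoc d (g zero) _ ⟩
  d + (g zero + sum (tabulate (g ∘ suc)))  ∎
  where open ≡-Reasoning
sum-tabulate-update {d = d} {f} {g} (suc i₀) f≡g fi₀≡ = begin
  f zero + sum (tabulate (f ∘ suc))
    ≡⟨ cong₂ _+_ (f≡g zero λ ()) (sum-tabulate-update i₀ f∘suc≡g∘suc fi₀≡) ⟩
  g zero + (d + sum (tabulate (g ∘ suc)))  ≡⟨ x∙yz≈y∙xz (g zero) d _ ⟩
  d + (g zero + sum (tabulate (g ∘ suc)))  ∎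
  where
  open ≡-Reasoning
  f∘suc≡g∘suc : ∀ i → i ≢ i₀ → f (suc i) ≡ g (suc i)
  f∘suc≡g∘suc i i≢i₀ = f≡g (suc i) (i≢i₀ ∘ suc-injective)

sum-allFin-update : ∀ {m d} {f g : Fin m → ℕ} (i₀ : Fin m) →
                    (∀ i → i ≢ i₀ → f i ≡ g i) → f i₀ ≡ d + g i₀ →
                    sum (map f (allFin m)) ≡ d + sum (map g (allFin m))
sum-allFin-update {m} {d} {f} {g} i₀ f≡g fi₀≡ = begin
  sum (map f (allFin m))      ≡⟨ cong sum (map-tabulate id f) ⟩
  sum (tabulate f)            ≡⟨ sum-tabulate-update i₀ f≡g fi₀≡ ⟩
  d + sum (tabulate g)        ≡⟨ cong (λ xs → d + sum xs) (map-tabulate id g) ⟨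
  d + sum (map g (allFin m))  ∎
  where open ≡-Reasoning

injective⇒strictlySurjective : ∀ {m} {f : Fin m → Fin m} →
                               Injective _≡_ _≡_ f → StrictlySurjective _≡_ f
injective⇒strictlySurjective {suc m} {f} f-injective y with any? (λ x → f x ≟ y)
... | yes hit  = hit
... | no  miss = ⊥-elim (1+n≰n (injective⇒≤ f-punchOut-injective))
  where
  y≢f : ∀ x → y ≢ f x
  y≢f x y≡fx = miss (x , sym y≡fx)

  f-punchOut : Fin (suc m) → Fin m
  f-punchOut x = punchOut (y≢f x)

  f-punchOut-injective : Injective _≡_ _≡_ f-punchOut
  f-punchOut-injective {x} {x'} eq = f-injective (punchOut-injective (y≢f x) (y≢f x') eq)

cyclicPred : ∀ {m} → Fin (suc m) → Fin (suc m)
cyclicPred zero    = fromℕ _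
cyclicPred (suc i) = inject₁ i

cyclicPred-injective : ∀ {m} → Injective _≡_ _≡_ (cyclicPred {m})
cyclicPred-injective {x = zero}  {zero}  _  = refl
cyclicPred-injective {x = zero}  {suc y} eq = ⊥-elim (fromℕ≢inject₁ eq)
cyclicPred-injective {x = suc x} {zero}  eq = ⊥-elim (fromℕ≢inject₁ (sym eq))
cyclicPred-injective {x = suc x} {suc y} eq = cong suc (inject₁-injective eq)

cyclicPred-≢ : ∀ {m} (i : Fin (suc (suc m))) → cyclicPred i ≢ i
cyclicPred-≢ zero    ()
cyclicPred-≢ (suc i) eq = 1+n≢n (trans (cong toℕ (sym eq)) (toℕ-inject₁ i))

Triple : ℕ → Set
Triple n = Fin n × Fin n × Fin n

module _ {n : ℕ} where

  _≐_ : Triples n → Triples n → Set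
  A ≐ B = A ⊆T B × B ⊆T A

  ⊆T-refl : {A : Triples n} → A ⊆T A
  ⊆T-refl _ _ _ h = h

  ⊆T-trans : {A B C : Triples n} → A ⊆T B → B ⊆T C → A ⊆T C
  ⊆T-trans A⊆B B⊆C r c s = B⊆C r c s ∘ A⊆B r c s

  ∩T-mono : {A A' B B' : Triples n} → A ⊆T A' → B ⊆T B' → (A ∩T B) ⊆T (A' ∩T B')
  ∩T-mono {A} A⊆A' B⊆B' r c s h =
    cong₂ _∧_ (A⊆A' r c s (∧-conicalˡ _ _ h)) (B⊆B' r c s (∧-conicalʳ (A r c s) _ h))

  ∅ : Triples n
  ∅ _ _ _ = false

  card-mono : {A B : Triples n} → A ⊆T B → card A ≤ card B
  card-mono A⊆B =
    sum-map-mono (allFin n) λ r → sum-map-mono (allFin n) λ c → sum-map-mono (allFin n) λ s →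
      indicator-mono (A⊆B r c s)

  card-∅ : card ∅ ≡ 0
  card-∅ = sum-map-zero (allFin n) λ _ → sum-map-zero (allFin n) λ _ → sum-map-zero (allFin n) λ _ → refl

  card-nonempty : {A : Triples n} → 1 ≤ card A → ∃[ r ] ∃[ c ] ∃[ s ] A r c s ≡ true
  card-nonempty {A} 1≤card with any? (λ r → any? λ c → any? λ s → A r c s ≟ᵇ true)
  ... | yes nonempty = nonempty
  ... | no  empty    = ⊥-elim (1+n≰n (subst (1 ≤_) card-∅ (≤-trans 1≤card (card-mono A⊆∅))))
    where
    A⊆∅ : A ⊆T ∅
    A⊆∅ r c s h = ⊥-elim (empty (r , c , s , h))

  _≟₃_ : DecidableEquality (Triple n)
  _≟₃_ = ≡-dec _≟_ (≡-dec _≟_ _≟_)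

  _-_ : Triples n → Triple n → Triples n
  (A - t) r c s = if does ((r , c , s) ≟₃ t) then false else A r c s

  minus-≢ : {A : Triples n} {t : Triple n} {r c s : Fin n} →
            (r , c , s) ≢ t → (A - t) r c s ≡ A r c s
  minus-≢ {t = t} {r} {c} {s} rcs≢t rewrite dec-false ((r , c , s) ≟₃ t) rcs≢t = refl

  minus-self : {A : Triples n} {r c s : Fin n} → (A - (r , c , s)) r c s ≡ false
  minus-self {r = r} {c} {s} rewrite dec-true ((r , c , s) ≟₃ (r , c , s)) refl = refl

  ∉-minus : {A : Triples n} {r c s : Fin n} → ¬ (A - (r , c , s)) r c s ≡ true
  ∉-minus {A} {r} {c} {s} h with () ← trans (sym (minus-self {A} {r} {c} {s})) h

  ∈-minus : {A : Triples n} {t : Triple n} {r c s : Fin n} →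
            A r c s ≡ true → (r , c , s) ≢ t → (A - t) r c s ≡ true
  ∈-minus {A} h rcs≢t = trans (minus-≢ {A} rcs≢t) h

  ∈-minus⇒≢ : {A : Triples n} {t : Triple n} {r c s : Fin n} →
              (A - t) r c s ≡ true → (r , c , s) ≢ t
  ∈-minus⇒≢ {A} h refl = ∉-minus {A} h

  minus-⊆ : {A : Triples n} {t : Triple n} → (A - t) ⊆T A
  minus-⊆ {A} {t} r c s h with (r , c , s) ≟₃ t
  ... | no _ = h

  minus-∩T : {A B : Triples n} {t : Triple n} → ((A ∩T B) - t) ⊆T ((A - t) ∩T B)
  minus-∩T {A} {B} {t} r c s h =
    cong₂ _∧_ (∈-minus {A} (∧-conicalˡ _ _ rcs∈A∩B) (∈-minus⇒≢ {A ∩T B} h)) (∧-conicalʳ (A r c s) _ rcs∈A∩B)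
    where
    rcs∈A∩B : (A ∩T B) r c s ≡ true
    rcs∈A∩B = minus-⊆ {A ∩T B} {t} r c s h

  card-minus : (A : Triples n) (r₀ c₀ s₀ : Fin n) →
               card A ≡ indicator (A r₀ c₀ s₀) + card (A - (r₀ , c₀ , s₀))
  card-minus A r₀ c₀ s₀ =
    sum-allFin-update r₀
      (λ r r≢r₀ → sum-map-cong (allFin n) λ c → sum-map-cong (allFin n) λ s → same (r≢r₀ ∘ cong proj₁))
      (sum-allFin-update c₀
        (λ c c≢c₀ → sum-map-cong (allFin n) λ s → same (c≢c₀ ∘ cong (proj₁ ∘ proj₂)))
        (sum-allFin-update s₀
          (λ s s≢s₀ → same (s≢s₀ ∘ cong (proj₂ ∘ proj₂)))
          (sym (trans (cong (λ b → indicator (A r₀ c₀ s₀) + indicator b) (minus-self {A})) (+-identityʳ _)))))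
    where
    same : ∀ {r c s} → (r , c , s) ≢ (r₀ , c₀ , s₀) →
           indicator (A r c s) ≡ indicator ((A - (r₀ , c₀ , s₀)) r c s)
    same rcs≢t = cong indicator (sym (minus-≢ {A} rcs≢t))

  card-minus-< : {A : Triples n} {r c s : Fin n} → A r c s ≡ true → card (A - (r , c , s)) < card A
  card-minus-< {A} {r} {c} {s} h =
    ≤-reflexive (sym (trans (card-minus A r c s) (cong (λ b → indicator b + card (A - (r , c , s))) h)))

  card-≤-suc-minus : (A : Triples n) (t : Triple n) → card A ≤ suc (card (A - t))
  card-≤-suc-minus A (r , c , s) =
    ≤-trans (≤-reflexive (card-minus A r c s)) (+-monoˡ-≤ _ (indicator-≤1 (A r c s)))

  IsPLS-⊆ : {A B : Triples n} → A ⊆T B → IsPLS B → IsPLS A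
  IsPLS-⊆ A⊆B (cell , row , col) =
    (λ r c s s' h h' → cell r c s s' (A⊆B r c s h) (A⊆B r c s' h')) ,
    (λ r c c' s h h' → row r c c' s (A⊆B r c s h) (A⊆B r c' s h')) ,
    (λ r r' c s h h' → col r r' c s (A⊆B r c s h) (A⊆B r' c s h'))

  -- IsLatinTrade T unfolds to IsPLS T × (T nonempty) × ∃ (Mate T).
  Mate : Triples n → Triples n → Set
  Mate T T' =
    IsPLS T' ×
    (∀ r c s → T r c s ≡ true → ¬ (T' r c s ≡ true)) ×
    (∀ r c → (∃[ s ] T r c s ≡ true) ⇔ (∃[ s ] T' r c s ≡ true)) ×
    (∀ r s → (∃[ c ] T r c s ≡ true) ⇔ (∃[ c ] T' r c s ≡ true)) ×
    (∀ c s → (∃[ r ] T r c s ≡ true) ⇔ (∃[ r ] T' r c s ≡ true))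

  ∃-true-⇔ : {f g : Fin n → Bool} → (∀ x → f x ≡ true → g x ≡ true) → (∀ x → g x ≡ true → f x ≡ true) →
             (∃[ x ] f x ≡ true) ⇔ (∃[ x ] g x ≡ true)
  ∃-true-⇔ f⊆g g⊆f = mk⇔ (λ (x , h) → x , f⊆g x h) (λ (x , h) → x , g⊆f x h)

  Mate-resp : {T₁ T₂ T₁' T₂' : Triples n} → T₁ ≐ T₂ → T₁' ≐ T₂' → Mate T₁ T₁' → Mate T₂ T₂'
  Mate-resp (T₁⊆T₂ , T₂⊆T₁) (T₁'⊆T₂' , T₂'⊆T₁') (pls , disjoint , cells , rows , cols) =
    IsPLS-⊆ T₂'⊆T₁' pls ,
    (λ r c s h h' → disjoint r c s (T₂⊆T₁ r c s h) (T₂'⊆T₁' r c s h')) ,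
    (λ r c → ⇔-trans (∃-true-⇔ (T₂⊆T₁ r c) (T₁⊆T₂ r c))
               (⇔-trans (cells r c) (∃-true-⇔ (T₁'⊆T₂' r c) (T₂'⊆T₁' r c)))) ,
    (λ r s → ⇔-trans (∃-true-⇔ (λ c → T₂⊆T₁ r c s) (λ c → T₁⊆T₂ r c s))
               (⇔-trans (rows r s) (∃-true-⇔ (λ c → T₁'⊆T₂' r c s) (λ c → T₂'⊆T₁' r c s)))) ,
    (λ c s → ⇔-trans (∃-true-⇔ (λ r → T₂⊆T₁ r c s) (λ r → T₁⊆T₂ r c s))
               (⇔-trans (cols c s) (∃-true-⇔ (λ r → T₁'⊆T₂' r c s) (λ r → T₂'⊆T₁' r c s))))

  IsLatinTrade-resp : IsLatinTrade Respects _≐_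
  IsLatinTrade-resp (T₁⊆T₂ , T₂⊆T₁) (pls , (r , c , s , h) , T' , mate) =
    IsPLS-⊆ T₂⊆T₁ pls , (r , c , s , T₁⊆T₂ r c s h) , T' , Mate-resp (T₁⊆T₂ , T₂⊆T₁) (⊆T-refl , ⊆T-refl) mate

  covers-every-symbol : {g : Fin n → Fin n → Bool} →
                        (∀ x → ∃[ s ] g x s ≡ true) → (∀ x x' s → g x s ≡ true → g x' s ≡ true → x ≡ x') →
                        ∀ s → ∃[ x ] g x s ≡ true
  covers-every-symbol {g} filled unique s =
    let x , symbol≡s = injective⇒strictlySurjective symbol-injective s
    in x , subst (λ s' → g x s' ≡ true) symbol≡s (proj₂ (filled x))
    where
    symbol : Fin n → Fin n
    symbol x = proj₁ (filled x)

    symbol-injective : Injective _≡_ _≡_ symbol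
    symbol-injective {x} {x'} eq =
      unique x x' (symbol x) (proj₂ (filled x)) (subst (λ s' → g x' s' ≡ true) (sym eq) (proj₂ (filled x')))

  row-complete : {L : Triples n} → IsLatinSquare L → ∀ r s → ∃[ c ] L r c s ≡ true
  row-complete ((_ , row , _) , filled) r = covers-every-symbol (filled r) (row r)

  col-complete : {L : Triples n} → IsLatinSquare L → ∀ c s → ∃[ r ] L r c s ≡ true
  col-complete ((_ , _ , col) , filled) c = covers-every-symbol (λ r → filled r c) (λ r r' s → col r r' c s)

  disjoint⇒Mate : {L L' : Triples n} → IsLatinSquare L → IsLatinSquare L' →
                  (∀ r c s → L r c s ≡ true → ¬ (L' r c s ≡ true)) → Mate L L'
  disjoint⇒Mate L-latin@(_ , filled) L'-latin@(L'-pls , filled') disjoint =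
    L'-pls , disjoint ,
    (λ r c → mk⇔ (λ _ → filled' r c) (λ _ → filled r c)) ,
    (λ r s → mk⇔ (λ _ → row-complete L'-latin r s) (λ _ → row-complete L-latin r s)) ,
    (λ c s → mk⇔ (λ _ → col-complete L'-latin c s) (λ _ → col-complete L-latin c s))

  IsLatinSquare-permuteRows : {L : Triples n} {σ : Fin n → Fin n} → Injective _≡_ _≡_ σ →
                              IsLatinSquare L → IsLatinSquare (L ∘ σ)
  IsLatinSquare-permuteRows {σ = σ} σ-injective ((cell , row , col) , filled) =
    ((cell ∘ σ) , (row ∘ σ) , λ r r' c s h h' → σ-injective (col (σ r) (σ r') c s h h')) , filled ∘ σ

IsLatinSquare⇒IsLatinTrade : ∀ {m} {L : Triples (suc (suc m))} → IsLatinSquare L → IsLatinTrade L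
IsLatinSquare⇒IsLatinTrade {L = L} L-latin@((_ , _ , col) , filled) =
  proj₁ L-latin , (zero , zero , filled zero zero) , L ∘ cyclicPred ,
  disjoint⇒Mate L-latin (IsLatinSquare-permuteRows cyclicPred-injective L-latin)
    λ r c s h h' → cyclicPred-≢ r (sym (col r (cyclicPred r) c s h h'))

module _ {n : ℕ} where

  index : Triple n → Fin (n * (n * n))
  index (r , c , s) = combine r (combine c s)

  unindex : Fin (n * (n * n)) → Triple n
  unindex = map₂ (remQuot n) ∘ remQuot (n * n)

  unindex-index : (t : Triple n) → unindex (index t) ≡ t
  unindex-index (r , c , s) = begin
    map₂ (remQuot n) (remQuot (n * n) (combine r (combine c s)))  ≡⟨ cong (map₂ (remQuot n)) (remQuot-combine r _) ⟩
    r , remQuot n (combine c s)                                   ≡⟨ cong (r ,_) (remQuot-combine c s) ⟩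
    r , c , s                                                     ∎
    where open ≡-Reasoning

  fromSubset : Subset (n * (n * n)) → Triples n
  fromSubset p r c s = lookup p (index (r , c , s))

  toSubset : Triples n → Subset (n * (n * n))
  toSubset A = tabulateᵛ ((λ (r , c , s) → A r c s) ∘ unindex)

  fromSubset-toSubset : (A : Triples n) → ∀ r c s → fromSubset (toSubset A) r c s ≡ A r c s
  fromSubset-toSubset A r c s =
    trans (lookup∘tabulate _ (index (r , c , s)))
          (cong (λ (r' , c' , s') → A r' c' s') (unindex-index (r , c , s)))

  ≐-fromSubset-toSubset : (A : Triples n) → fromSubset (toSubset A) ≐ A
  ≐-fromSubset-toSubset A =
    (λ r c s h → trans (sym (fromSubset-toSubset A r c s)) h) ,
    (λ r c s h → trans (fromSubset-toSubset A r c s) h)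

  -- Without function extensionality, transporting P along fromSubset (toSubset A) ≐ A
  -- needs P to respect ≐.
  any-Triples? : {P : Triples n → Set} → P Respects _≐_ → (∀ A → Dec (P A)) → Dec (∃ P)
  any-Triples? resp P? =
    map-dec (mk⇔ (λ (p , Pp) → fromSubset p , Pp)
                 (λ (A , PA) → toSubset A , resp (swap (≐-fromSubset-toSubset A)) PA))
            (anySubset? (P? ∘ fromSubset))

  all-Triples? : {P : Triples n → Set} → P Respects _≐_ → (∀ A → Dec (P A)) → Dec (∀ A → P A)
  all-Triples? {P} resp P?
    with any-Triples? {λ A → ¬ P A} (λ A≐B ¬PA PB → ¬PA (resp (swap A≐B) PB)) (¬? ∘ P?)
  ... | yes (A , ¬PA) = no λ all-P → ¬PA (all-P A)
  ... | no  ∄¬P       = yes λ A → decidable-stable (P? A) λ ¬PA → ∄¬P (A , ¬PA)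

  isTrue? : (b : Bool) → Dec (b ≡ true)
  isTrue? b = b ≟ᵇ true

  line? : (f : Fin n → Bool) → Dec (∃[ x ] f x ≡ true)
  line? f = any? (isTrue? ∘ f)

  _⇔-dec_ : {A B : Set} → Dec A → Dec B → Dec (A ⇔ B)
  a? ⇔-dec b? =
    map-dec (mk⇔ (uncurry mk⇔) (λ A⇔B → Equivalence.to A⇔B , Equivalence.from A⇔B))
            ((a? →-dec b?) ×-dec (b? →-dec a?))

  ⊆T? : (A B : Triples n) → Dec (A ⊆T B)
  ⊆T? A B = all? λ r → all? λ c → all? λ s → isTrue? (A r c s) →-dec isTrue? (B r c s)

  IsPLS? : (T : Triples n) → Dec (IsPLS T)
  IsPLS? T =
    (all? λ r → all? λ c → all? λ s → all? λ s' → isTrue? (T r c s) →-dec isTrue? (T r c s') →-dec s ≟ s') ×-dec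
    (all? λ r → all? λ c → all? λ c' → all? λ s → isTrue? (T r c s) →-dec isTrue? (T r c' s) →-dec c ≟ c') ×-dec
    (all? λ r → all? λ r' → all? λ c → all? λ s → isTrue? (T r c s) →-dec isTrue? (T r' c s) →-dec r ≟ r')

  Mate? : (T T' : Triples n) → Dec (Mate T T')
  Mate? T T' =
    IsPLS? T' ×-dec
    (all? λ r → all? λ c → all? λ s → isTrue? (T r c s) →-dec ¬? (isTrue? (T' r c s))) ×-dec
    (all? λ r → all? λ c → line? (T r c) ⇔-dec line? (T' r c)) ×-dec
    (all? λ r → all? λ s → line? (λ c → T r c s) ⇔-dec line? (λ c → T' r c s)) ×-dec
    (all? λ c → all? λ s → line? (λ r → T r c s) ⇔-dec line? (λ r → T' r c s))

  IsLatinTrade? : (T : Triples n) → Dec (IsLatinTrade T)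
  IsLatinTrade? T =
    IsPLS? T ×-dec
    (any? λ r → any? λ c → line? (T r c)) ×-dec
    any-Triples? (Mate-resp (⊆T-refl , ⊆T-refl)) (Mate? T)

  module _ (k : ℕ) (L : Triples n) where

    IsKStrong? : (S : Triples n) → Dec (IsKStrong k L S)
    IsKStrong? S = ⊆T? S L ×-dec all-Triples? meets-resp meets?
      where
      meets? : ∀ T → Dec (T ⊆T L → IsLatinTrade T → k ≤ card (S ∩T T))
      meets? T = ⊆T? T L →-dec IsLatinTrade? T →-dec k ≤? card (S ∩T T)

      meets-resp : (λ T → T ⊆T L → IsLatinTrade T → k ≤ card (S ∩T T)) Respects _≐_
      meets-resp (T₁⊆T₂ , T₂⊆T₁) meets T₂⊆L T₂-trade =
        ≤-trans (meets (⊆T-trans T₁⊆T₂ T₂⊆L) (IsLatinTrade-resp (T₂⊆T₁ , T₁⊆T₂) T₂-trade))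
                (card-mono (∩T-mono {A = S} ⊆T-refl T₁⊆T₂))

    IsKStrong-mono : {S S' : Triples n} → S' ⊆T S → S ⊆T L → IsKStrong k L S' → IsKStrong k L S
    IsKStrong-mono S'⊆S S⊆L (_ , meets) =
      S⊆L , λ T T⊆L T-trade → ≤-trans (meets T T⊆L T-trade) (card-mono (∩T-mono S'⊆S ⊆T-refl))

    IsKStrong-minus : {S : Triples n} (t : Triple n) → IsKStrong k L S → IsKStrong (k ∸ 1) L (S - t)
    IsKStrong-minus {S} t (S⊆L , meets) = ⊆T-trans (minus-⊆ {A = S}) S⊆L , λ T T⊆L T-trade →
      ∸-monoˡ-≤ 1 (begin
        k                          ≤⟨ meets T T⊆L T-trade ⟩
        card (S ∩T T)              ≤⟨ card-≤-suc-minus (S ∩T T) t ⟩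
        suc (card ((S ∩T T) - t))  ≤⟨ s≤s (card-mono (minus-∩T {A = S})) ⟩
        suc (card ((S - t) ∩T T))  ∎)
      where open ≤-Reasoning

    no-strong-deletion⇒minimal : {S : Triples n} → IsKStrong k L S →
                                 (∀ r c s → S r c s ≡ true → ¬ IsKStrong k L (S - (r , c , s))) →
                                 IsMinimallyKStrong k L S
    no-strong-deletion⇒minimal {S} S-strong@(S⊆L , _) deletion-weak =
      S-strong , λ S' (S'⊆S , r , c , s , rcs∈S , rcs∉S') S'-strong →
        deletion-weak r c s rcs∈S
          (IsKStrong-mono (S'⊆S-rcs S'⊆S rcs∉S') (⊆T-trans (minus-⊆ {A = S}) S⊆L) S'-strong)
      where
      S'⊆S-rcs : ∀ {S' r c s} → S' ⊆T S → ¬ S' r c s ≡ true → S' ⊆T (S - (r , c , s))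
      S'⊆S-rcs S'⊆S rcs∉S' r' c' s' h = ∈-minus {A = S} (S'⊆S r' c' s' h) λ { refl → rcs∉S' h }

    minimal-⊆ : {S : Triples n} → IsKStrong k L S → ∃[ Q ] (Q ⊆T S × IsMinimallyKStrong k L Q)
    minimal-⊆ {S} = shrink S (<-wellFounded (card S))
      where
      shrink : ∀ S → Acc _<_ (card S) → IsKStrong k L S → ∃[ Q ] (Q ⊆T S × IsMinimallyKStrong k L Q)
      shrink S (acc smaller) S-strong
        with any? (λ r → any? λ c → any? λ s → isTrue? (S r c s) ×-dec IsKStrong? (S - (r , c , s)))
      ... | yes (r , c , s , rcs∈S , S-rcs-strong) =
            let Q , Q⊆S-rcs , Q-minimal =
                  shrink (S - (r , c , s)) (smaller (card-minus-< {A = S} rcs∈S)) S-rcs-strong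
            in Q , ⊆T-trans Q⊆S-rcs (minus-⊆ {A = S}) , Q-minimal
      ... | no none = S , ⊆T-refl , no-strong-deletion⇒minimal S-strong
                                      λ r c s rcs∈S S-rcs-strong → none (r , c , s , rcs∈S , S-rcs-strong)

  proper-minimal-subset : (k : ℕ) (L P : Triples n) {r c s : Fin n} → IsKStrong k L P → P r c s ≡ true →
                          ∃[ Q ] (Q ⊊T P × IsMinimallyKStrong (k ∸ 1) L Q)
  proper-minimal-subset k L P {r} {c} {s} P-strong rcs∈P =
    let Q , Q⊆P-rcs , Q-minimal = minimal-⊆ (k ∸ 1) L (IsKStrong-minus k L (r , c , s) P-strong)
    in Q , (⊆T-trans Q⊆P-rcs (minus-⊆ {A = P}) , r , c , s , rcs∈P , ∉-minus {A = P} ∘ Q⊆P-rcs r c s) ,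
       Q-minimal

lemma3 : (n : ℕ) → 2 ≤ n → (L : Triples n) → IsLatinSquare L →
         (k : ℕ) → 1 ≤ k → (P : Triples n) → IsMinimallyKStrong k L P →
         ∃[ Q ] (Q ⊊T P × IsMinimallyKStrong (k ∸ 1) L Q)
lemma3 (suc (suc m)) _ L L-latin k 1≤k P (P-strong@(_ , meets) , _) =
  let L-trade = IsLatinSquare⇒IsLatinTrade L-latin
      _ , _ , _ , rcs∈P∩L = card-nonempty {A = P ∩T L} (≤-trans 1≤k (meets L ⊆T-refl L-trade))
  in proper-minimal-subset k L P P-strong (∧-conicalˡ _ _ rcs∈P∩L)
lemma3 1 (s≤s ())
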